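{- Let $p,p',p''\geq 5$ be three distinct primes. Then the common non-ranks of $p,p',p''$ form $8=2^3$ arithmetic progressions with common difference $2pp'p''$: there are exactly $8$ distinct residue classes modulo $2pp'p''$ such that, for all sufficiently large integers $t$, $t$ is a common non-rank of $p,p',p''$ if and only if $t$ lies in one of these classes.
   Context: For real $x$, $N(x)$ is the integer nearest to $x$. For a prime $q\geq 5$, the non-ranks of $q$ are the integers $(2n+1)q+4N(q/6)$ with $n\geq 0$ and $(2n+1)q-4N(q/6)$ with $n\geq 1$. A common non-rank of several primes is an integer that is a non-rank of each of them. -}

module Defs where

open import Data.Nat as ℕ using (ℕ; suc; _/_)
open import Data.Integer using (ℤ; +_; _+_; _-_; _*_)
open import Data.Product using (∃-syntax; _×_)
open import Data.Sum using (_⊎_)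
open import Relation.Binary.PropositionalEquality using (_≡_)

-- N(q/6): the integer nearest to q/6, computed as ⌊q/6 + 1/2⌋ = ⌊(q+3)/6⌋.
-- For primes q ≥ 5 we have q mod 6 ∈ {1,5}, so q/6 is never a tie and this
-- is unambiguously the nearest integer.
nearestSixth : ℕ → ℕ
nearestSixth q = (q ℕ.+ 3) / 6

IsNonRank : ℕ → ℤ → Set
IsNonRank q t =
  (∃[ n ] t ≡ + ((2 ℕ.* n ℕ.+ 1) ℕ.* q) + + (4 ℕ.* nearestSixth q))
  ⊎ (∃[ n ] (1 ℕ.≤ n × t ≡ + ((2 ℕ.* n ℕ.+ 1) ℕ.* q) - + (4 ℕ.* nearestSixth q)))

IsCommonNonRank3 : ℕ → ℕ → ℕ → ℤ → Set
IsCommonNonRank3 p p' p'' t = IsNonRank p t × IsNonRank p' t × IsNonRank p'' t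

-- For large t, t is a non-rank of q exactly when t ≡ q ± 4N(q/6) (mod 2q): writing
-- t = r + k·2q with r < 2q, the two families of the definition correspond to the two
-- values of r, and the lower family only misses its first term, which lies below 2q.
-- Both residues are odd, so modulo 2q such a congruence is oddness plus a congruence
-- modulo q. Since 2, p, p', p'' are pairwise coprime, the Chinese remainder theorem
-- turns each of the 2·2·2 choices of residues into a single class modulo 2pp'p'', and
-- distinct choices give distinct classes because the two residues of each prime differ
-- and are < 2q.
module Submission where

open import Data.Fin using (Fin)
open import Data.Fin.Patterns using (0F; 1F)
open import Data.Fin.Properties using (*↔×)
open import Data.Integer as ℤ using (ℤ; +_; _-_; _⊖_)
import Data.Integer.Properties as ℤ
open import Data.Integer.Divisibility using (_∣_)
open import Data.Nat as ℕ using (ℕ; _≥_; _<_)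
open import Data.Nat.Base
open import Data.Nat.Properties
open import Data.Nat.DivMod
import Data.Nat.Divisibility as ℕ using (_∣_)
open import Data.Nat.Divisibility using (divides; m∣m*n; n∣m*n; m%n≡0⇒n∣m)
open import Data.Nat.Coprimality as Coprimality using (Coprime; coprime-Bézout; coprime-divisor)
open import Data.Nat.GCD using (module Bézout)
open import Data.Nat.Primality
  using (Prime; prime[2]; prime⇒irreducible; prime⇒nonTrivial; prime⇒nonZero; euclidsLemma)
open import Data.Nat.Tactic.RingSolver using (solve-∀)
open import Data.Product using (Σ; ∃-syntax; _×_; _,_; proj₁; proj₂)
open import Data.Product.Function.NonDependent.Propositional using (_×-⇔_; _×-↔_)
open import Data.Sum using (inj₁; inj₂; [_,_]′)
open import Function.Base using (_∘_)
open import Function.Bundles using (_⇔_; mk⇔; Equivalence; _↔_; Inverse; Injection)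
open import Function.Construct.Composition using (_⇔-∘_; _↔-∘_)
open import Function.Construct.Identity using (↔-id)
open import Function.Definitions using (Injective)
open import Function.Properties.Inverse using (↔⇒↣)
open import Relation.Binary.PropositionalEquality
open import Relation.Nullary using (¬_; contradiction)

open import Defs

infix 4 _≡_[mod_]

_≡_[mod_] : ℕ → ℕ → (m : ℕ) .{{_ : NonZero m}} → Set
x ≡ y [mod m ] = x % m ≡ y % m

module _ {m : ℕ} .{{_ : NonZero m}} where

  ≡[mod]⇒∣∸ : ∀ {x y} → y ≤ x → x ≡ y [mod m ] → m ℕ.∣ x ∸ y
  ≡[mod]⇒∣∸ {x} {y} y≤x x≡y = divides (x / m ∸ y / m) (begin
    x ∸ y                                     ≡⟨ cong₂ _∸_ (m≡m%n+[m/n]*n x m) (m≡m%n+[m/n]*n y m) ⟩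
    (x % m + x / m * m) ∸ (y % m + y / m * m) ≡⟨ cong (λ r → (r + x / m * m) ∸ (y % m + y / m * m)) x≡y ⟩
    (y % m + x / m * m) ∸ (y % m + y / m * m) ≡⟨ [m+n]∸[m+o]≡n∸o (y % m) _ _ ⟩
    x / m * m ∸ y / m * m                     ≡⟨ *-distribʳ-∸ m (x / m) (y / m) ⟨
    (x / m ∸ y / m) * m                       ∎)
    where open ≡-Reasoning

  ∣∸⇒≡[mod] : ∀ {x y} → y ≤ x → m ℕ.∣ x ∸ y → x ≡ y [mod m ]
  ∣∸⇒≡[mod] {x} {y} y≤x (divides k x∸y≡km) = begin
    x % m             ≡⟨ cong (_% m) (m+[n∸m]≡n y≤x) ⟨
    (y + (x ∸ y)) % m ≡⟨ cong (λ d → (y + d) % m) x∸y≡km ⟩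
    (y + k * m) % m   ≡⟨ [m+kn]%n≡m%n y k m ⟩
    y % m             ∎
    where open ≡-Reasoning

  ≡[mod]-+ˡ : ∀ a {x y} → x ≡ y [mod m ] → a + x ≡ a + y [mod m ]
  ≡[mod]-+ˡ a {x} {y} x≡y = begin
    (a + x) % m           ≡⟨ %-distribˡ-+ a x m ⟩
    (a % m + x % m) % m   ≡⟨ cong (λ r → (a % m + r) % m) x≡y ⟩
    (a % m + y % m) % m   ≡⟨ %-distribˡ-+ a y m ⟨
    (a + y) % m           ∎
    where open ≡-Reasoning

  ≡[mod]-*ˡ : ∀ c {x y} → x ≡ y [mod m ] → c * x ≡ c * y [mod m ]
  ≡[mod]-*ˡ c {x} {y} x≡y = begin
    (c * x) % m           ≡⟨ %-distribˡ-* c x m ⟩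
    (c % m * (x % m)) % m ≡⟨ cong (λ r → (c % m * r) % m) x≡y ⟩
    (c % m * (y % m)) % m ≡⟨ %-distribˡ-* c y m ⟨
    (c * y) % m           ∎
    where open ≡-Reasoning

≡[mod]-∣ : ∀ {d m x y} .{{_ : NonZero d}} .{{_ : NonZero m}} → d ℕ.∣ m → x ≡ y [mod m ] → x ≡ y [mod d ]
≡[mod]-∣ {d} {m} {x} {y} d∣m x≡y = begin
  x % d      ≡⟨ m∣n⇒o%n%m≡o%m d m x d∣m ⟨
  x % m % d  ≡⟨ cong (_% d) x≡y ⟩
  y % m % d  ≡⟨ m∣n⇒o%n%m≡o%m d m y d∣m ⟩
  y % d      ∎
  where open ≡-Reasoning

≡[mod]-⇔ʳ : ∀ {m x y z} .{{_ : NonZero m}} → y ≡ z [mod m ] → x ≡ y [mod m ] ⇔ x ≡ z [mod m ]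
≡[mod]-⇔ʳ y≡z = mk⇔ (λ x≡y → trans x≡y y≡z) (λ x≡z → trans x≡z (sym y≡z))

≡[mod]-<⇒≡ : ∀ {m x y} .{{_ : NonZero m}} → x < m → y < m → x ≡ y [mod m ] → x ≡ y
≡[mod]-<⇒≡ x<m y<m x≡y = trans (sym (m<n⇒m%n≡m x<m)) (trans x≡y (m<n⇒m%n≡m y<m))

≡[mod]⇒≡+quotient : ∀ {m x r} .{{_ : NonZero m}} → r < m → x ≡ r [mod m ] → x ≡ r + x / m * m
≡[mod]⇒≡+quotient {m} {x} r<m x≡r =
  trans (m≡m%n+[m/n]*n x m) (cong (_+ x / m * m) (trans x≡r (m<n⇒m%n≡m r<m)))

+∣-⇔≡[mod] : ∀ {m} .{{_ : NonZero m}} n r → (+ m ∣ + n - + r) ⇔ n ≡ r [mod m ]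
+∣-⇔≡[mod] {m} n r with ≤-total r n
... | inj₁ r≤n = mk⇔ (∣∸⇒≡[mod] r≤n ∘ subst (m ℕ.∣_) ∣n-r∣≡n∸r)
                     (subst (m ℕ.∣_) (sym ∣n-r∣≡n∸r) ∘ ≡[mod]⇒∣∸ r≤n)
  where
  ∣n-r∣≡n∸r : ℤ.∣ + n - + r ∣ ≡ n ∸ r
  ∣n-r∣≡n∸r = cong ℤ.∣_∣ (trans (ℤ.[+m]-[+n]≡m⊖n n r) (ℤ.⊖-≥ r≤n))
... | inj₂ n≤r = mk⇔ (sym ∘ ∣∸⇒≡[mod] n≤r ∘ subst (m ℕ.∣_) ∣n-r∣≡r∸n)
                     (subst (m ℕ.∣_) (sym ∣n-r∣≡r∸n) ∘ ≡[mod]⇒∣∸ n≤r ∘ sym)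
  where
  ∣n-r∣≡r∸n : ℤ.∣ + n - + r ∣ ≡ r ∸ n
  ∣n-r∣≡r∸n = trans (cong ℤ.∣_∣ (ℤ.[+m]-[+n]≡m⊖n n r)) (ℤ.∣⊖∣-≤ n≤r)

coprime⇒*∣ : ∀ {m n d} → Coprime m n → m ℕ.∣ d → n ℕ.∣ d → m * n ℕ.∣ d
coprime⇒*∣ {m} {n} {d} coprime (divides k d≡km) n∣d
  with divides j k≡jn ← coprime-divisor (Coprimality.sym coprime) (subst (n ℕ.∣_) (trans d≡km (*-comm k m)) n∣d)
  = divides j (begin
    d           ≡⟨ d≡km ⟩
    k * m       ≡⟨ cong (_* m) k≡jn ⟩
    j * n * m   ≡⟨ *-assoc j n m ⟩
    j * (n * m) ≡⟨ cong (j *_) (*-comm n m) ⟩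
    j * (m * n) ∎)
  where open ≡-Reasoning

-- The modulus m * n carries its own NonZero instance: a generic instance for products
-- would make instance search loop on numerals.
≡[mod]-combine : ∀ {m n x y} .{{_ : NonZero m}} .{{_ : NonZero n}} .{{_ : NonZero (m * n)}} → Coprime m n →
                 x ≡ y [mod m ] → x ≡ y [mod n ] → x ≡ y [mod m * n ]
≡[mod]-combine {m} {n} {x} {y} coprime x≡y[m] x≡y[n] with ≤-total y x
... | inj₁ y≤x =
  ∣∸⇒≡[mod] y≤x (coprime⇒*∣ coprime (≡[mod]⇒∣∸ y≤x x≡y[m]) (≡[mod]⇒∣∸ y≤x x≡y[n]))
... | inj₂ x≤y =
  sym (∣∸⇒≡[mod] x≤y (coprime⇒*∣ coprime (≡[mod]⇒∣∸ x≤y (sym x≡y[m])) (≡[mod]⇒∣∸ x≤y (sym x≡y[n]))))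

≡[mod*]⇔ : ∀ {m n x y} .{{_ : NonZero m}} .{{_ : NonZero n}} .{{_ : NonZero (m * n)}} → Coprime m n →
           x ≡ y [mod m * n ] ⇔ (x ≡ y [mod m ] × x ≡ y [mod n ])
≡[mod*]⇔ {m} {n} coprime = mk⇔
  (λ x≡y → ≡[mod]-∣ (m∣m*n n) x≡y , ≡[mod]-∣ (n∣m*n m) x≡y)
  (λ (x≡y[m] , x≡y[n]) → ≡[mod]-combine coprime x≡y[m] x≡y[n])

≡[mod2*]⇔ : ∀ {q x r} .{{_ : NonZero q}} .{{_ : NonZero (2 * q)}} → Coprime 2 q →
            x ≡ 1 [mod 2 ] → r ≡ 1 [mod 2 ] → x ≡ r [mod 2 * q ] ⇔ x ≡ r [mod q ]
≡[mod2*]⇔ coprime x-odd r-odd = mk⇔ (proj₂ ∘ to) (λ x≡r → from (trans x-odd (sym r-odd) , x≡r))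
  where open Equivalence (≡[mod*]⇔ coprime)

coprime⇒inverse : ∀ {m n} .{{_ : NonZero n}} → Coprime m n → ∃[ u ] u * m ≡ 1 [mod n ]
coprime⇒inverse {m} {n@(suc n-1)} coprime with coprime-Bézout coprime
... | Bézout.+- x y 1+yn≡xm = x , (begin
  x * m % n          ≡⟨ cong (_% n) 1+yn≡xm ⟨
  (1 + y * n) % n    ≡⟨ [m+kn]%n≡m%n 1 y n ⟩
  1 % n              ∎)
  where open ≡-Reasoning
-- Here x·m ≡ -1 (mod n), so (n - 1)·x inverts m.
... | Bézout.-+ x y 1+xm≡yn = n-1 * x , (begin
  n-1 * x * m % n                    ≡⟨ [m+kn]%n≡m%n (n-1 * x * m) 1 n ⟨
  (n-1 * x * m + 1 * n) % n          ≡⟨ cong (_% n) (lemma₁ n-1 x m) ⟩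
  (n-1 * (1 + x * m) + 1) % n        ≡⟨ cong (λ r → (n-1 * r + 1) % n) 1+xm≡yn ⟩
  (n-1 * (y * n) + 1) % n            ≡⟨ cong (_% n) (lemma₂ n-1 y) ⟩
  (1 + n-1 * y * n) % n              ≡⟨ [m+kn]%n≡m%n 1 (n-1 * y) n ⟩
  1 % n                              ∎)
  where
  open ≡-Reasoning
  lemma₁ : ∀ a b c → a * b * c + 1 * suc a ≡ a * (1 + b * c) + 1
  lemma₁ = solve-∀
  lemma₂ : ∀ a b → a * (b * suc a) + 1 ≡ 1 + a * b * suc a
  lemma₂ = solve-∀

crt : ∀ {m n} .{{_ : NonZero m}} .{{_ : NonZero n}} → Coprime m n →
      ∀ a b → ∃[ z ] (z ≡ a [mod m ] × z ≡ b [mod n ])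
-- c ≡ b - a (mod n) and u·m ≡ 1 (mod n), so a + c·u·m ≡ b (mod n).
crt {m} {n@(suc n-1)} coprime a b with u , um≡1 ← coprime⇒inverse coprime =
  a + c * u * m , [m+kn]%n≡m%n a (c * u) m , z≡b
  where
  c : ℕ
  c = b + n-1 * a
  z≡b : a + c * u * m ≡ b [mod n ]
  z≡b = begin
    (a + c * u * m) % n    ≡⟨ cong (λ r → (a + r) % n) (*-assoc c u m) ⟩
    (a + c * (u * m)) % n  ≡⟨ ≡[mod]-+ˡ a (≡[mod]-*ˡ c um≡1) ⟩
    (a + c * 1) % n        ≡⟨ cong (_% n) (lemma a b n-1) ⟩
    (b + a * n) % n        ≡⟨ [m+kn]%n≡m%n b a n ⟩
    b % n                  ∎
    where
    open ≡-Reasoning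
    lemma : ∀ a b k → a + (b + k * a) * 1 ≡ b + a * suc k
    lemma = solve-∀

IsResidueClass : (m : ℕ) .{{_ : NonZero m}} → (ℕ → Set) → Set
IsResidueClass m P = ∃[ z ] (z < m × (∀ x → x ≡ z [mod m ] ⇔ P x))

≡[mod]-isResidueClass : ∀ {m} .{{_ : NonZero m}} a → IsResidueClass m (λ x → x ≡ a [mod m ])
≡[mod]-isResidueClass {m} a = a % m , m%n<n a m , λ _ → ≡[mod]-⇔ʳ (m%n%n≡m%n a m)

isResidueClass-⇔ : ∀ {m P Q} .{{_ : NonZero m}} → (∀ x → P x ⇔ Q x) → IsResidueClass m P → IsResidueClass m Q
isResidueClass-⇔ P⇔Q (z , z<m , ≡z⇔P) = z , z<m , λ x → P⇔Q x ⇔-∘ ≡z⇔P x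

isResidueClass-×≡ : ∀ {m n P} .{{_ : NonZero m}} .{{_ : NonZero n}} .{{_ : NonZero (m * n)}} →
                    Coprime m n → IsResidueClass m P → ∀ b →
                    IsResidueClass (m * n) (λ x → P x × x ≡ b [mod n ])
isResidueClass-×≡ coprime (z , _ , ≡z⇔P) b with w , w≡z , w≡b ← crt coprime z b =
  isResidueClass-⇔ (λ x → ((≡z⇔P x ⇔-∘ ≡[mod]-⇔ʳ w≡z) ×-⇔ ≡[mod]-⇔ʳ w≡b) ⇔-∘ ≡[mod*]⇔ coprime)
                   (≡[mod]-isResidueClass w)

prime∤⇒coprime : ∀ {m q} → Prime q → ¬ q ℕ.∣ m → Coprime m q
prime∤⇒coprime q-prime q∤m (d∣m , d∣q) with prime⇒irreducible q-prime d∣q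
... | inj₁ d≡1    = d≡1
... | inj₂ refl   = contradiction d∣m q∤m

prime∤prime : ∀ {p q} → Prime p → Prime q → p ≢ q → ¬ p ℕ.∣ q
prime∤prime p-prime q-prime p≢q p∣q with prime⇒irreducible q-prime p∣q
... | inj₁ p≡1 = nonTrivial⇒≢1 {{prime⇒nonTrivial p-prime}} p≡1
... | inj₂ p≡q = p≢q p≡q

prime∤* : ∀ {q m n} → Prime q → ¬ q ℕ.∣ m → ¬ q ℕ.∣ n → ¬ q ℕ.∣ m * n
prime∤* {m = m} {n} q-prime q∤m q∤n q∣mn = [ q∤m , q∤n ]′ (euclidsLemma m n q-prime q∣mn)

¬2∣⇒odd : ∀ {n} → ¬ 2 ℕ.∣ n → n ≡ 1 [mod 2 ]
¬2∣⇒odd {n} 2∤n = remainder (n % 2) refl (m%n<n n 2)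
  where
  remainder : ∀ r → n % 2 ≡ r → r < 2 → r ≡ 1
  remainder 0 n%2≡0 _ = contradiction (m%n≡0⇒n∣m n 2 n%2≡0) 2∤n
  remainder 1 _     _ = refl
  remainder (2+ _) _ (s≤s (s≤s ()))

prime≢2⇒odd : ∀ {q} → Prime q → q ≢ 2 → q ≡ 1 [mod 2 ]
prime≢2⇒odd q-prime q≢2 = ¬2∣⇒odd (prime∤prime prime[2] q-prime (q≢2 ∘ sym))

prime≢2⇒coprime2 : ∀ {q} → Prime q → q ≢ 2 → Coprime 2 q
prime≢2⇒coprime2 q-prime q≢2 = prime∤⇒coprime q-prime (prime∤prime q-prime prime[2] q≢2)

δ : ℕ → ℕ
δ q = 4 * nearestSixth q

residue : ℕ → Fin 2 → ℕ
residue q 0F = q + δ q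
residue q 1F = q ∸ δ q

module _ {q : ℕ} (5≤q : 5 ≤ q) where

  0<δ : 0 < δ q
  0<δ = ≤-trans (s≤s z≤n) (*-monoʳ-≤ 4 (m≥n⇒m/n>0 (≤-trans (m≤n+m 6 2) (+-monoˡ-≤ 3 5≤q))))

  δ<q : δ q < q
  δ<q = 4n<q (nearestSixth q) (m/n*n≤m (q + 3) 6)
    where
    4n<q : ∀ n → n * 6 ≤ q + 3 → 4 * n < q
    4n<q 0        _      = ≤-trans (s≤s z≤n) 5≤q
    4n<q 1        _      = 5≤q
    4n<q (2+ k) 6n≤q+3 = begin-strict
      4 * (2 + k) <⟨ ≤-reflexive (lemma₁ k) ⟩
      9 + k * 4   ≤⟨ +-monoʳ-≤ 9 (*-monoʳ-≤ k (m≤m+n 4 2)) ⟩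
      9 + k * 6   ≤⟨ +-cancelʳ-≤ 3 _ _ (subst (_≤ q + 3) (lemma₂ k) 6n≤q+3) ⟩
      q           ∎
      where
      open ≤-Reasoning
      lemma₁ : ∀ k → suc (4 * (2 + k)) ≡ 9 + k * 4
      lemma₁ = solve-∀
      lemma₂ : ∀ k → (2 + k) * 6 ≡ 9 + k * 6 + 3
      lemma₂ = solve-∀

  residue≤q+δ : ∀ s → residue q s ≤ q + δ q
  residue≤q+δ 0F = ≤-refl
  residue≤q+δ 1F = ≤-trans (m∸n≤m q (δ q)) (m≤m+n q (δ q))

  residue<2q : ∀ s → residue q s < 2 * q
  residue<2q s = <-≤-trans (≤-<-trans (residue≤q+δ s) (+-monoʳ-< q δ<q))
                           (≤-reflexive (cong (_+_ q) (sym (+-identityʳ q))))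

  residue₁<residue₀ : residue q 1F < residue q 0F
  residue₁<residue₀ = <-≤-trans (∸-monoʳ-< 0<δ (<⇒≤ δ<q)) (m≤m+n q (δ q))

  residue-injective : ∀ {s t} → residue q s ≡ residue q t → s ≡ t
  residue-injective {0F} {0F} _  = refl
  residue-injective {0F} {1F} eq = contradiction (sym eq) (<⇒≢ residue₁<residue₀)
  residue-injective {1F} {0F} eq = contradiction eq (<⇒≢ residue₁<residue₀)
  residue-injective {1F} {1F} _  = refl

  δ≡2N*2 : δ q ≡ 2 * nearestSixth q * 2
  δ≡2N*2 = 4n≡2n*2 (nearestSixth q)
    where
    4n≡2n*2 : ∀ n → 4 * n ≡ 2 * n * 2
    4n≡2n*2 = solve-∀

  residue-odd : q ≡ 1 [mod 2 ] → ∀ s → residue q s ≡ 1 [mod 2 ]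
  residue-odd q-odd 0F = begin
    (q + δ q) % 2            ≡⟨ cong (λ d → (q + d) % 2) δ≡2N*2 ⟩
    (q + 2 * N * 2) % 2      ≡⟨ [m+kn]%n≡m%n q (2 * N) 2 ⟩
    q % 2                    ≡⟨ q-odd ⟩
    1                        ∎
    where
    open ≡-Reasoning
    N : ℕ
    N = nearestSixth q
  residue-odd q-odd 1F = begin
    (q ∸ δ q) % 2                ≡⟨ [m+kn]%n≡m%n (q ∸ δ q) (2 * N) 2 ⟨
    (q ∸ δ q + 2 * N * 2) % 2    ≡⟨ cong (λ d → (q ∸ δ q + d) % 2) δ≡2N*2 ⟨
    (q ∸ δ q + δ q) % 2          ≡⟨ cong (_% 2) (m∸n+n≡m (<⇒≤ δ<q)) ⟩
    q % 2                        ≡⟨ q-odd ⟩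
    1                            ∎
    where
    open ≡-Reasoning
    N : ℕ
    N = nearestSixth q

  odd-multiple : ∀ k → (2 * k + 1) * q ≡ q + k * (2 * q)
  odd-multiple k = lemma q k
    where
    lemma : ∀ q k → (2 * k + 1) * q ≡ q + k * (2 * q)
    lemma = solve-∀

  upper-form : ∀ k → (2 * k + 1) * q + δ q ≡ residue q 0F + k * (2 * q)
  upper-form k = begin
    (2 * k + 1) * q + δ q    ≡⟨ cong (_+ δ q) (odd-multiple k) ⟩
    q + k * (2 * q) + δ q    ≡⟨ +-assoc q _ (δ q) ⟩
    q + (k * (2 * q) + δ q)  ≡⟨ cong (_+_ q) (+-comm _ (δ q)) ⟩
    q + (δ q + k * (2 * q))  ≡⟨ +-assoc q (δ q) _ ⟨
    q + δ q + k * (2 * q)    ∎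
    where open ≡-Reasoning

  lower-form : ∀ k → + ((2 * k + 1) * q) - + δ q ≡ + (residue q 1F + k * (2 * q))
  lower-form k = begin
    + ((2 * k + 1) * q) - + δ q    ≡⟨ ℤ.[+m]-[+n]≡m⊖n _ (δ q) ⟩
    (2 * k + 1) * q ⊖ δ q          ≡⟨ ℤ.⊖-≥ δ≤X ⟩
    + ((2 * k + 1) * q ∸ δ q)      ≡⟨ cong (λ x → + (x ∸ δ q)) (odd-multiple k) ⟩
    + ((q + k * (2 * q)) ∸ δ q)    ≡⟨ cong +_ (+-∸-comm _ (<⇒≤ δ<q)) ⟩
    + (q ∸ δ q + k * (2 * q))      ∎
    where
    open ≡-Reasoning
    δ≤X : δ q ≤ (2 * k + 1) * q
    δ≤X = ≤-trans (<⇒≤ δ<q) (≤-trans (m≤m+n q _) (≤-reflexive (sym (odd-multiple k))))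

  module _ .{{_ : NonZero (2 * q)}} where

    nonRank⇒≡residue : ∀ {n} → IsNonRank q (+ n) → ∃[ s ] n ≡ residue q s [mod 2 * q ]
    nonRank⇒≡residue (inj₁ (k , n≡)) =
      0F , trans (cong (_% (2 * q)) (trans (ℤ.+-injective n≡) (upper-form k))) ([m+kn]%n≡m%n _ k (2 * q))
    nonRank⇒≡residue (inj₂ (k , _ , n≡)) =
      1F , trans (cong (_% (2 * q)) (ℤ.+-injective (trans n≡ (lower-form k)))) ([m+kn]%n≡m%n _ k (2 * q))

    ≡residue⇒nonRank : ∀ {n} s → 2 * q ≤ n → n ≡ residue q s [mod 2 * q ] → IsNonRank q (+ n)
    ≡residue⇒nonRank {n} s 2q≤n n≡r = fromQuotient s (n / (2 * q)) (≡[mod]⇒≡+quotient (residue<2q s) n≡r)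
      where
      fromQuotient : ∀ s k → n ≡ residue q s + k * (2 * q) → IsNonRank q (+ n)
      fromQuotient 0F k n≡ = inj₁ (k , cong +_ (trans n≡ (sym (upper-form k))))
      -- The lower family starts at n = 1, so its residue itself is not a non-rank.
      fromQuotient 1F 0 n≡ =
        contradiction (≤-trans 2q≤n (≤-reflexive (trans n≡ (+-identityʳ _)))) (<⇒≱ (residue<2q 1F))
      fromQuotient 1F (suc k) n≡ = inj₂ (suc k , s≤s z≤n , sym (trans (lower-form (suc k)) (cong +_ (sym n≡))))

    nonRank⇔ : ∀ {n} → 2 * q ≤ n → IsNonRank q (+ n) ⇔ (∃[ s ] n ≡ residue q s [mod 2 * q ])
    nonRank⇔ 2q≤n = mk⇔ nonRank⇒≡residue (λ (s , n≡r) → ≡residue⇒nonRank s 2q≤n n≡r)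

    residue-unique : ∀ {s t} → residue q s ≡ residue q t [mod 2 * q ] → s ≡ t
    residue-unique {s} {t} = residue-injective ∘ ≡[mod]-<⇒≡ (residue<2q s) (residue<2q t)

module CommonNonRanks
  {p p' p'' : ℕ} (p-prime : Prime p) (p'-prime : Prime p') (p''-prime : Prime p'')
  (5≤p : 5 ≤ p) (5≤p' : 5 ≤ p') (5≤p'' : 5 ≤ p'')
  (p≢p' : p ≢ p') (p≢p'' : p ≢ p'') (p'≢p'' : p' ≢ p'')
  where

  M : ℕ
  M = 2 * p * p' * p''

  instance
    p≢0 : NonZero p
    p≢0 = prime⇒nonZero p-prime
    p'≢0 : NonZero p'
    p'≢0 = prime⇒nonZero p'-prime
    p''≢0 : NonZero p''
    p''≢0 = prime⇒nonZero p''-prime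
    2p≢0 : NonZero (2 * p)
    2p≢0 = m*n≢0 2 p
    2p'≢0 : NonZero (2 * p')
    2p'≢0 = m*n≢0 2 p'
    2p''≢0 : NonZero (2 * p'')
    2p''≢0 = m*n≢0 2 p''
    2pp'≢0 : NonZero (2 * p * p')
    2pp'≢0 = m*n≢0 (2 * p) p'
    M≢0 : NonZero M
    M≢0 = m*n≢0 (2 * p * p') p''

  ≥5⇒≢2 : ∀ {q} → 5 ≤ q → q ≢ 2
  ≥5⇒≢2 5≤q = >⇒≢ (≤-trans (m≤n+m 3 2) 5≤q)

  coprime[2p,p'] : Coprime (2 * p) p'
  coprime[2p,p'] = prime∤⇒coprime p'-prime
    (prime∤* p'-prime (prime∤prime p'-prime prime[2] (≥5⇒≢2 5≤p'))
                      (prime∤prime p'-prime p-prime (p≢p' ∘ sym)))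

  coprime[2pp',p''] : Coprime (2 * p * p') p''
  coprime[2pp',p''] = prime∤⇒coprime p''-prime
    (prime∤* p''-prime
      (prime∤* p''-prime (prime∤prime p''-prime prime[2] (≥5⇒≢2 5≤p''))
                         (prime∤prime p''-prime p-prime (p≢p'' ∘ sym)))
      (prime∤prime p''-prime p'-prime (p'≢p'' ∘ sym)))

  Choice : Set
  Choice = Fin 2 × Fin 2 × Fin 2

  Solves : Choice → ℕ → Set
  Solves (s , s' , s'') x =
    x ≡ residue p s [mod 2 * p ] × x ≡ residue p' s' [mod 2 * p' ] × x ≡ residue p'' s'' [mod 2 * p'' ]

  solutionClass : ∀ c → IsResidueClass M (Solves c)
  solutionClass (s , s' , s'') =
    isResidueClass-⇔ Solves⇔
      (isResidueClass-×≡ coprime[2pp',p'']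
        (isResidueClass-×≡ coprime[2p,p'] (≡[mod]-isResidueClass (residue p s)) (residue p' s'))
        (residue p'' s''))
    where
    oddPrimeResidue : ∀ {q} → Prime q → 5 ≤ q → ∀ s → residue q s ≡ 1 [mod 2 ]
    oddPrimeResidue q-prime 5≤q = residue-odd 5≤q (prime≢2⇒odd q-prime (≥5⇒≢2 5≤q))
    lift : ∀ {q} .{{_ : NonZero q}} .{{_ : NonZero (2 * q)}} {x} → Prime q → 5 ≤ q → ∀ s →
           x ≡ 1 [mod 2 ] → x ≡ residue q s [mod q ] → x ≡ residue q s [mod 2 * q ]
    lift q-prime 5≤q s x-odd = Equivalence.from
      (≡[mod2*]⇔ (prime≢2⇒coprime2 q-prime (≥5⇒≢2 5≤q)) x-odd (oddPrimeResidue q-prime 5≤q s))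
    Solves⇔ : ∀ x → ((x ≡ residue p s [mod 2 * p ] × x ≡ residue p' s' [mod p' ])
                       × x ≡ residue p'' s'' [mod p'' ])
                    ⇔ Solves (s , s' , s'') x
    Solves⇔ x = mk⇔
      (λ ((x≡r , x≡r') , x≡r'') →
         x≡r , lift p'-prime 5≤p' s' (odd x≡r) x≡r' , lift p''-prime 5≤p'' s'' (odd x≡r) x≡r'')
      (λ (x≡r , x≡r' , x≡r'') → (x≡r , ≡[mod]-∣ {x = x} {residue p' s'} (n∣m*n 2) x≡r') ,
                                 ≡[mod]-∣ {x = x} {residue p'' s''} (n∣m*n 2) x≡r'')
      where
      odd : x ≡ residue p s [mod 2 * p ] → x ≡ 1 [mod 2 ]
      odd x≡r = trans (≡[mod]-∣ (m∣m*n p) x≡r) (oddPrimeResidue p-prime 5≤p s)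

  solves-unique : ∀ {c c' x} → Solves c x → Solves c' x → c ≡ c'
  solves-unique {s₁ , s₂ , s₃} {t₁ , t₂ , t₃} (a₁ , a₂ , a₃) (b₁ , b₂ , b₃) =
    cong₂ _,_ (residue-unique 5≤p (trans (sym a₁) b₁))
      (cong₂ _,_ (residue-unique 5≤p' (trans (sym a₂) b₂)) (residue-unique 5≤p'' (trans (sym a₃) b₃)))

  representative : Choice → ℕ
  representative c = proj₁ (solutionClass c)

  ≡representative⇔ : ∀ c x → x ≡ representative c [mod M ] ⇔ Solves c x
  ≡representative⇔ c = proj₂ (proj₂ (solutionClass c))

  representative-injective : Injective _≡_ _≡_ representative
  representative-injective {c} {c'} eq = solves-unique (solves c) (subst (Solves c') (sym eq) (solves c'))
    where
    solves : ∀ c → Solves c (representative c)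
    solves c = Equivalence.to (≡representative⇔ c (representative c)) refl

  T : ℕ
  T = 2 * p + 2 * p' + 2 * p''

  commonNonRank⇔solves : ∀ {n} → T ≤ n → IsCommonNonRank3 p p' p'' (+ n) ⇔ (∃[ c ] Solves c n)
  commonNonRank⇔solves {n} T≤n =
    mk⇔ (λ ((s , e) , (s' , e') , (s'' , e'')) → (s , s' , s'') , e , e' , e'')
        (λ ((s , s' , s'') , e , e' , e'') → (s , e) , (s' , e') , (s'' , e''))
    ⇔-∘ (nonRank⇔ 5≤p 2p≤n ×-⇔ nonRank⇔ 5≤p' 2p'≤n ×-⇔ nonRank⇔ 5≤p'' 2p''≤n)
    where
    2p≤n : 2 * p ≤ n
    2p≤n = ≤-trans (≤-trans (m≤m+n _ _) (m≤m+n _ _)) T≤n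
    2p'≤n : 2 * p' ≤ n
    2p'≤n = ≤-trans (≤-trans (m≤n+m _ (2 * p)) (m≤m+n _ _)) T≤n
    2p''≤n : 2 * p'' ≤ n
    2p''≤n = ≤-trans (m≤n+m _ (2 * p + 2 * p')) T≤n

  choices : Fin 8 ↔ Choice
  choices = (↔-id (Fin 2) ×-↔ *↔× {2} {2}) ↔-∘ *↔× {2} {4}

  open Inverse choices using () renaming (to to choice; from to index; strictlyInverseˡ to choice∘index)

  r : Fin 8 → ℕ
  r = representative ∘ choice

  r<M : ∀ i → r i < M
  r<M i = proj₁ (proj₂ (solutionClass (choice i)))

  r-injective : Injective _≡_ _≡_ r
  r-injective = Injection.injective (↔⇒↣ choices) ∘ representative-injective

  commonNonRank⇔ : ∀ t → + T ℤ.≤ t → IsCommonNonRank3 p p' p'' t ⇔ (∃[ i ] (+ M ∣ t - + r i))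
  commonNonRank⇔ (+ n) (ℤ.+≤+ T≤n) = mk⇔ reindex unindex ⇔-∘ commonNonRank⇔solves T≤n
    where
    open Equivalence using (to; from)
    reindex : ∃[ c ] Solves c n → ∃[ i ] (+ M ∣ + n - + r i)
    reindex (c , n-solves) = index c , from (+∣-⇔≡[mod] n _)
      (subst (λ c → n ≡ representative c [mod M ]) (sym (choice∘index c)) (from (≡representative⇔ c n) n-solves))
    unindex : ∃[ i ] (+ M ∣ + n - + r i) → ∃[ c ] Solves c n
    unindex (i , M∣n-r) = choice i , to (≡representative⇔ (choice i) n) (to (+∣-⇔≡[mod] n (r i)) M∣n-r)

theorem3p11 : (p p' p'' : ℕ) → Prime p → Prime p' → Prime p'' →
    p ≥ 5 → p' ≥ 5 → p'' ≥ 5 → p ≢ p' → p ≢ p'' → p' ≢ p'' →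
    Σ (Fin 8 → ℕ) λ r → ((∀ i → r i < 2 ℕ.* p ℕ.* p' ℕ.* p'') ×
      Injective _≡_ _≡_ r ×
      ∃[ T ] (∀ (t : ℤ) → T ℤ.≤ t →
        (IsCommonNonRank3 p p' p'' t ⇔
          (∃[ i ] (+ (2 ℕ.* p ℕ.* p' ℕ.* p'') ∣ t - + r i)))))
theorem3p11 p p' p'' p-prime p'-prime p''-prime 5≤p 5≤p' 5≤p'' p≢p' p≢p'' p'≢p'' =
  r , r<M , r-injective , + T , commonNonRank⇔
  where open CommonNonRanks p-prime p'-prime p''-prime 5≤p 5≤p' 5≤p'' p≢p' p≢p'' p'≢p''
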